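{- Let $\mathbf{L}=(L,\sqsubseteq,\otimes,1,\Rightarrow_l,\Rightarrow_r)$ be a residuated pomonoid with a monotone unary operation $!$ satisfying $!1=1$. Then a unary operation $?$ on $L$ satisfies (c1) $!(a\Rightarrow_i b)\sqsubseteq ?a\Rightarrow_i ?b$ for $i=l,r$ and all $a,b\in L$ if and only if $?$ is monotone and satisfies, for all $a,b\in L$, (c6) $!a\otimes ?b\sqsubseteq ?(a\otimes b)$ and (c7) $?a\otimes !b\sqsubseteq ?(a\otimes b)$.
   Context: A residuated pomonoid is a structure $(L,\sqsubseteq,\otimes,1,\Rightarrow_l,\Rightarrow_r)$ where $\sqsubseteq$ is a partial order on $L$, $(L,\otimes,1)$ is a monoid with $\otimes$ monotone in each argument, and $\Rightarrow_l,\Rightarrow_r$ are binary operations satisfying the residuation law: $a\sqsubseteq b\Rightarrow_l c$ iff $a\otimes b\sqsubseteq c$ iff $b\sqsubseteq a\Rightarrow_r c$. -}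

module Defs where

open import Level using (Level; suc; _⊔_)
open import Relation.Binary.PropositionalEquality using (_≡_)
open import Relation.Binary.Structures using (IsPartialOrder)
open import Algebra.Structures using (IsMonoid)
open import Data.Product using (_×_)
open import Function.Bundles using (_⇔_)

record ResiduatedPomonoid (c ℓ : Level) : Set (suc (c ⊔ ℓ)) where
  infix  4 _⊑_
  infixl 7 _⊗_
  infixr 5 _⇒l_ _⇒r_
  field
    L         : Set c
    _⊑_       : L → L → Set ℓ
    _⊗_       : L → L → L
    𝟙         : L
    _⇒l_      : L → L → L
    _⇒r_      : L → L → L
    isPartialOrder : IsPartialOrder _≡_ _⊑_
    isMonoid  : IsMonoid _≡_ _⊗_ 𝟙
    ⊗-monoˡ   : ∀ {a a′} b → a ⊑ a′ → a ⊗ b ⊑ a′ ⊗ b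
    ⊗-monoʳ   : ∀ a {b b′} → b ⊑ b′ → a ⊗ b ⊑ a ⊗ b′
    residˡ    : ∀ a b c → (a ⊑ b ⇒l c) ⇔ (a ⊗ b ⊑ c)
    residʳ    : ∀ a b c → (b ⊑ a ⇒r c) ⇔ (a ⊗ b ⊑ c)

module _ {c ℓ} (𝐋 : ResiduatedPomonoid c ℓ) where
  open ResiduatedPomonoid 𝐋

  Monotone : (L → L) → Set (c ⊔ ℓ)
  Monotone f = ∀ {a b} → a ⊑ b → f a ⊑ f b

  C1 : (bang qm : L → L) → Set (c ⊔ ℓ)
  C1 bang qm = (∀ a b → bang (a ⇒l b) ⊑ qm a ⇒l qm b)
         × (∀ a b → bang (a ⇒r b) ⊑ qm a ⇒r qm b)

  C6 : (bang qm : L → L) → Set (c ⊔ ℓ)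
  C6 bang qm = ∀ a b → bang a ⊗ qm b ⊑ qm (a ⊗ b)

  C7 : (bang qm : L → L) → Set (c ⊔ ℓ)
  C7 bang qm = ∀ a b → qm a ⊗ bang b ⊑ qm (a ⊗ b)

module Submission where

-- The proof uses only the two residuation laws, through their unit and
-- counit forms:  a ⊑ b ⇒l (a ⊗ b),  (a ⇒l b) ⊗ a ⊑ b,  and symmetrically
-- for ⇒r.  Each implication is established separately, for one residual
-- at a time:
--   * the left half of (c1) gives monotonicity of ? (apply it to
--     1 ⊑ a ⇒l b and use !1 = 1) and (c6) (apply it to a ⊑ b ⇒l (a ⊗ b));
--     the right half gives (c7) in the same way;
--   * conversely, monotonicity of ? together with (c6) gives the left half
--     of (c1) (apply ? to the counit (a ⇒l b) ⊗ a ⊑ b), and together with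
--     (c7) the right half.

open import Defs
open import Relation.Binary.PropositionalEquality using (_≡_; subst; sym)
open import Data.Product using (_×_; _,_)
open import Function.Bundles using (_⇔_; mk⇔; Equivalence)
open import Relation.Binary.Structures using (IsPartialOrder)
open import Algebra.Structures using (IsMonoid)

module ModalConditions {c ℓ} (𝐋 : ResiduatedPomonoid c ℓ) where
  open ResiduatedPomonoid 𝐋
  open IsPartialOrder isPartialOrder using (refl; trans)
  open IsMonoid isMonoid using (identityˡ)

  unitˡ : ∀ a b → a ⊑ b ⇒l (a ⊗ b)
  unitˡ a b = Equivalence.from (residˡ a b (a ⊗ b)) refl

  unitʳ : ∀ a b → b ⊑ a ⇒r (a ⊗ b)
  unitʳ a b = Equivalence.from (residʳ a b (a ⊗ b)) refl

  counitˡ : ∀ a b → (a ⇒l b) ⊗ a ⊑ b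
  counitˡ a b = Equivalence.to (residˡ (a ⇒l b) a b) refl

  counitʳ : ∀ a b → a ⊗ (a ⇒r b) ⊑ b
  counitʳ a b = Equivalence.to (residʳ a (a ⇒r b) b) refl

  internaliseˡ : ∀ {a b} → a ⊑ b → 𝟙 ⊑ a ⇒l b
  internaliseˡ {a} {b} a⊑b =
    Equivalence.from (residˡ 𝟙 a b) (subst (_⊑ b) (sym (identityˡ a)) a⊑b)

  externaliseˡ : ∀ {a b} → 𝟙 ⊑ a ⇒l b → a ⊑ b
  externaliseˡ {a} {b} 𝟙⊑a⇒b =
    subst (_⊑ b) (identityˡ a) (Equivalence.to (residˡ 𝟙 a b) 𝟙⊑a⇒b)

  module _ (bang qm : L → L) where

    C1ˡ : Set _
    C1ˡ = ∀ a b → bang (a ⇒l b) ⊑ qm a ⇒l qm b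

    C1ʳ : Set _
    C1ʳ = ∀ a b → bang (a ⇒r b) ⊑ qm a ⇒r qm b

    -- (c1) for ⇒l makes ? monotone, provided ! is monotone and fixes 1:
    -- a ⊑ b gives 1 = !1 ⊑ !(a ⇒l b) ⊑ ?a ⇒l ?b.
    C1ˡ⇒monotone : Monotone 𝐋 bang → bang 𝟙 ≡ 𝟙 → C1ˡ → Monotone 𝐋 qm
    C1ˡ⇒monotone bang-mono bang-𝟙 c1ˡ {a} {b} a⊑b = externaliseˡ
      (trans (subst (_⊑ bang (a ⇒l b)) bang-𝟙 (bang-mono (internaliseˡ a⊑b)))
             (c1ˡ a b))

    -- (c1) for ⇒l gives (c6): !a ⊑ !(b ⇒l (a ⊗ b)) ⊑ ?b ⇒l ?(a ⊗ b).
    C1ˡ⇒C6 : Monotone 𝐋 bang → C1ˡ → C6 𝐋 bang qm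
    C1ˡ⇒C6 bang-mono c1ˡ a b = Equivalence.to (residˡ (bang a) (qm b) (qm (a ⊗ b)))
      (trans (bang-mono (unitˡ a b)) (c1ˡ b (a ⊗ b)))

    -- (c1) for ⇒r gives (c7): !b ⊑ !(a ⇒r (a ⊗ b)) ⊑ ?a ⇒r ?(a ⊗ b).
    C1ʳ⇒C7 : Monotone 𝐋 bang → C1ʳ → C7 𝐋 bang qm
    C1ʳ⇒C7 bang-mono c1ʳ a b = Equivalence.to (residʳ (qm a) (bang b) (qm (a ⊗ b)))
      (trans (bang-mono (unitʳ a b)) (c1ʳ a (a ⊗ b)))

    -- Monotonicity of ? and (c6) give (c1) for ⇒l:
    -- !(a ⇒l b) ⊗ ?a ⊑ ?((a ⇒l b) ⊗ a) ⊑ ?b.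
    C6⇒C1ˡ : Monotone 𝐋 qm → C6 𝐋 bang qm → C1ˡ
    C6⇒C1ˡ qm-mono c6 a b = Equivalence.from (residˡ (bang (a ⇒l b)) (qm a) (qm b))
      (trans (c6 (a ⇒l b) a) (qm-mono (counitˡ a b)))

    -- Monotonicity of ? and (c7) give (c1) for ⇒r:
    -- ?a ⊗ !(a ⇒r b) ⊑ ?(a ⊗ (a ⇒r b)) ⊑ ?b.
    C7⇒C1ʳ : Monotone 𝐋 qm → C7 𝐋 bang qm → C1ʳ
    C7⇒C1ʳ qm-mono c7 a b = Equivalence.from (residʳ (qm a) (bang (a ⇒r b)) (qm b))
      (trans (c7 a (a ⇒r b)) (qm-mono (counitʳ a b)))

lemma3 : ∀ {c ℓ} (𝐋 : ResiduatedPomonoid c ℓ)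
    (bang : ResiduatedPomonoid.L 𝐋 → ResiduatedPomonoid.L 𝐋) →
    Monotone 𝐋 bang → bang (ResiduatedPomonoid.𝟙 𝐋) ≡ ResiduatedPomonoid.𝟙 𝐋 →
    (qm : ResiduatedPomonoid.L 𝐋 → ResiduatedPomonoid.L 𝐋) →
    C1 𝐋 bang qm ⇔ (Monotone 𝐋 qm × C6 𝐋 bang qm × C7 𝐋 bang qm)
lemma3 𝐋 bang bang-mono bang-𝟙 qm = mk⇔ to from
  where
  open ModalConditions 𝐋

  to : C1 𝐋 bang qm → Monotone 𝐋 qm × C6 𝐋 bang qm × C7 𝐋 bang qm
  to (c1ˡ , c1ʳ) = C1ˡ⇒monotone bang qm bang-mono bang-𝟙 c1ˡ
                 , C1ˡ⇒C6 bang qm bang-mono c1ˡ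
                 , C1ʳ⇒C7 bang qm bang-mono c1ʳ

  from : Monotone 𝐋 qm × C6 𝐋 bang qm × C7 𝐋 bang qm → C1 𝐋 bang qm
  from (qm-mono , c6 , c7) = C6⇒C1ˡ bang qm qm-mono c6 , C7⇒C1ʳ bang qm qm-mono c7
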